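{- Let $n\ge 3$ be odd. On $\textsf{Triangle}(n)$ there exists a sweep of length $3(n^2-1)/8$ starting and ending at the hole a1; in such a sweep every hole of the board is either jumped over or landed in by the sweeping peg. Concretely: starting from the board position with a peg at a1, pegs at every hole $(r,k)$ with $r$ or $k$ even, and all other holes empty, the peg at a1 can perform $3(n^2-1)/8$ consecutive jumps, ending at a1.
   Context: The board $\textsf{Triangle}(n)$ has the holes $(r,k)$ with integers $1\le k\le r\le n$ (row $r$ from the top, position $k$ from the left); hole $(r,k)$ is written as the $k$-th letter followed by $r$, so a1 $=(1,1)$ is the top corner. The six directions are $d\in\{(0,\pm1),(\pm1,0),(1,1),(-1,-1)\}$. A jump: if $h,h+d,h+2d$ are on the board, $h$ and $h+d$ hold pegs and $h+2d$ is empty, the peg at $h$ moves to $h+2d$ and the peg at $h+d$ is removed. A sweep of length $i$ ($i$-sweep) is a sequence of $i$ consecutive jumps all made by the same peg. -}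

module Defs where

open import Data.Bool using (Bool; true; false; if_then_else_; _∨_; _∧_)
open import Data.Nat as ℕ using (ℕ; _%_)
open import Data.Integer as ℤ using (ℤ; +_; -[1+_]; ∣_∣)
open import Data.Product using (_×_; _,_)
open import Data.List using (List; []; _∷_)
open import Relation.Nullary.Decidable using (⌊_⌋)
open import Relation.Binary.PropositionalEquality using (_≡_)

-- A hole (r , k): row r from the top, position k from the left.
Hole : Set
Hole = ℤ × ℤ

OnBoard : ℕ → Hole → Set
OnBoard n (r , k) = (+ 1 ℤ.≤ k) × (k ℤ.≤ r) × (r ℤ.≤ + n)

data Dir : Set where
  E W S N SE NW : Dir

vec : Dir → Hole
vec E  = (+ 0 , + 1)
vec W  = (+ 0 , -[1+ 0 ])
vec S  = (+ 1 , + 0)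
vec N  = (-[1+ 0 ] , + 0)
vec SE = (+ 1 , + 1)
vec NW = (-[1+ 0 ] , -[1+ 0 ])

_⊕_ : Hole → Dir → Hole
(r , k) ⊕ d with vec d
... | (a , b) = (r ℤ.+ a , k ℤ.+ b)

_==_ : Hole → Hole → Bool
(r , k) == (r' , k') = ⌊ r ℤ.≟ r' ⌋ ∧ ⌊ k ℤ.≟ k' ⌋

-- A board position: which holes hold a peg (true = peg).
Position : Set
Position = Hole → Bool

Jump : ℕ → Position → Hole → Dir → Set
Jump n p h d =
  OnBoard n h × OnBoard n (h ⊕ d) × OnBoard n ((h ⊕ d) ⊕ d) ×
  (p h ≡ true) × (p (h ⊕ d) ≡ true) × (p ((h ⊕ d) ⊕ d) ≡ false)

afterJump : Position → Hole → Dir → Position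
afterJump p h d x =
  if (x == h) ∨ (x == (h ⊕ d)) then false
  else if x == ((h ⊕ d) ⊕ d) then true
  else p x

data Sweep (n : ℕ) : Position → Hole → List Dir → Position → Hole → Set where
  done : ∀ {p h} → Sweep n p h [] p h
  step : ∀ {p h d ds p' h'} → Jump n p h d →
         Sweep n (afterJump p h d) ((h ⊕ d) ⊕ d) ds p' h' →
         Sweep n p h (d ∷ ds) p' h'

jumpedOver : Hole → List Dir → List Hole
jumpedOver h [] = []
jumpedOver h (d ∷ ds) = (h ⊕ d) ∷ jumpedOver ((h ⊕ d) ⊕ d) ds

landedIn : Hole → List Dir → List Hole
landedIn h [] = []
landedIn h (d ∷ ds) = ((h ⊕ d) ⊕ d) ∷ landedIn ((h ⊕ d) ⊕ d) ds

a1 : Hole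
a1 = (+ 1 , + 1)

isEven : ℤ → Bool
isEven z = ∣ z ∣ % 2 ℕ.≡ᵇ 0

initialPosition : Position
initialPosition (r , k) = ((r , k) == a1) ∨ isEven r ∨ isEven k

-- Write n = 2m+1. The holes with both coordinates odd are, apart from a1, exactly the
-- empty holes of the initial position. They form a triangular grid with m+1 rows whose
-- edges (pairs of grid holes two steps apart in direction E, S or SE) have exactly the
-- remaining holes as midpoints. A jump of the sweeping peg traverses a grid edge, and
-- the jumps stay legal as long as no edge is traversed twice: the peg is then the only
-- one on the grid, so it always lands in an empty hole, and every jumped hole still
-- holds its peg. A closed trail through all 3m(m+1)/2 edges is therefore the required
-- sweep. We take: run down the left edge, then clear the rows in pairs from the bottom
-- up, rows 2i+3 and 2i+2 by a run east along row 2i+3 followed by a zigzag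
-- (NW, S, NW, ..., NW) back along row 2i+2, which ends at the left end of row 2i+1.

module Submission where

open import Defs
open import Data.Bool using (true; false)
open import Data.Bool.Properties using (¬-not; ∨-zeroʳ; ∨-identityʳ)
open import Data.Nat as ℕ using (ℕ; zero; suc; pred; _≤_; s≤s; z≤n; _+_; _*_; _∸_; _%_; _/_)
open import Data.Nat.DivMod using (m≡m%n+[m/n]*n)
open import Data.Nat.Tactic.RingSolver using (solve-∀)
import Data.Nat.Properties as ℕ
open import Data.Integer as ℤ using (+_; 0ℤ)
import Data.Integer.Properties as ℤ
open import Algebra.Properties.AbelianGroup ℤ.+-0-abelianGroup using (∙-cancelˡ)
open import Data.List using (List; []; _∷_; _++_; map; length)
open import Data.List.Properties using (length-++)
open import Data.List.Relation.Unary.All as All using (All; []; _∷_)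
open import Data.List.Relation.Unary.AllPairs using ([]; _∷_)
open import Data.List.Relation.Unary.Unique.Propositional using (Unique)
import Data.List.Relation.Unary.Unique.Propositional.Properties as Unique
import Data.List.Relation.Unary.All.Properties as All
open import Data.List.Relation.Unary.Any using (here)
open import Data.List.Membership.Propositional using (_∈_)
open import Data.List.Membership.Propositional.Properties using (∈-++⁺ˡ; ∈-++⁺ʳ; ∈-map⁺)
import Data.Sum as Sum
open import Data.Product using (Σ; _×_; _,_; ∃; proj₁; proj₂; map₂)
open import Data.Sum using (_⊎_; inj₁; inj₂)
open import Level using (0ℓ)
open import Function using (_∘_)
open import Relation.Nullary using (¬_; yes; no; contradiction)
open import Relation.Unary using (Pred; _⊆_; _∪_; _⊥_; ｛_｝; ∅)
open import Relation.Binary.PropositionalEquality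

-- Legal sweeps

==-refl : ∀ x → (x == x) ≡ true
==-refl (r , k) with r ℤ.≟ r | k ℤ.≟ k
... | yes _   | yes _   = refl
... | yes _   | no k≢k  = contradiction refl k≢k
... | no r≢r  | _       = contradiction refl r≢r

==⇒≡ : ∀ {x y} → (x == y) ≡ true → x ≡ y
==⇒≡ {r , k} {r′ , k′} x=y with r ℤ.≟ r′ | k ℤ.≟ k′
==⇒≡ refl | yes refl | yes refl = refl

≢⇒==-false : ∀ {x y} → x ≢ y → (x == y) ≡ false
≢⇒==-false {x} {y} x≢y with x == y in x=y
... | true  = contradiction (==⇒≡ x=y) x≢y
... | false = refl

==-false⇒≢ : ∀ {x y} → (x == y) ≡ false → x ≢ y
==-false⇒≢ {x} x=y refl with () ← trans (sym (==-refl x)) x=y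

+-twice-≢ : ∀ k b → b ℤ.+ b ≢ 0ℤ → k ℤ.+ b ℤ.+ b ≢ k
+-twice-≢ k b 2b≢0 eq = 2b≢0 (∙-cancelˡ k (b ℤ.+ b) 0ℤ (begin
  k ℤ.+ (b ℤ.+ b)  ≡⟨ ℤ.+-assoc k b b ⟨
  k ℤ.+ b ℤ.+ b    ≡⟨ eq ⟩
  k                ≡⟨ ℤ.+-identityʳ k ⟨
  k ℤ.+ 0ℤ         ∎))
  where open ≡-Reasoning

landing-≢-origin : ∀ h d → (h ⊕ d) ⊕ d ≢ h
landing-≢-origin (r , k) E  eq = +-twice-≢ k _ (λ ()) (cong proj₂ eq)
landing-≢-origin (r , k) W  eq = +-twice-≢ k _ (λ ()) (cong proj₂ eq)
landing-≢-origin (r , k) S  eq = +-twice-≢ r _ (λ ()) (cong proj₁ eq)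
landing-≢-origin (r , k) N  eq = +-twice-≢ r _ (λ ()) (cong proj₁ eq)
landing-≢-origin (r , k) SE eq = +-twice-≢ r _ (λ ()) (cong proj₁ eq)
landing-≢-origin (r , k) NW eq = +-twice-≢ r _ (λ ()) (cong proj₁ eq)

module _ (p : Position) (h : Hole) (d : Dir) where

  private
    m v : Hole
    m = h ⊕ d
    v = m ⊕ d

  afterJump-landing : v ≢ h → v ≢ m → afterJump p h d v ≡ true
  afterJump-landing v≢h v≢m rewrite ≢⇒==-false v≢h | ≢⇒==-false v≢m | ==-refl v = refl

  afterJump-frame : ∀ {x} → x ≢ h → x ≢ m → x ≢ v → afterJump p h d x ≡ p x
  afterJump-frame x≢h x≢m x≢v
    rewrite ≢⇒==-false x≢h | ≢⇒==-false x≢m | ≢⇒==-false x≢v = refl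

  afterJump-peg : ∀ x → afterJump p h d x ≡ true → x ≡ v ⊎ (x ≢ h × p x ≡ true)
  afterJump-peg x peg with x == h in x=h | x == m | x == v in x=v
  ... | false | false | true  = inj₁ (==⇒≡ x=v)
  ... | false | false | false = inj₂ (==-false⇒≢ x=h , peg)

endHole : Hole → List Dir → Hole
endHole h []       = h
endHole h (d ∷ ds) = endHole ((h ⊕ d) ⊕ d) ds

sweep-of-route : ∀ {n} (V : Pred Hole 0ℓ) {p h} ds →
  OnBoard n h → V h → p h ≡ true → (∀ {x} → V x → p x ≡ true → x ≡ h) →
  All (λ x → OnBoard n x × V x) (landedIn h ds) →
  All (λ x → OnBoard n x × ¬ V x × p x ≡ true) (jumpedOver h ds) →
  Unique (jumpedOver h ds) →
  ∃ λ p′ → Sweep n p h ds p′ (endHole h ds)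
sweep-of-route V [] _ _ _ _ _ _ _ = _ , done
sweep-of-route {n} V {p} {h} (d ∷ ds) onh Vh ph onlyPeg
  ((onv , Vv) ∷ lands) ((onm , ¬Vm , pm) ∷ jumps) (m∉jumps ∷ unique) =
  map₂ (step (onh , onm , onv , ph , pm , pv))
       (sweep-of-route V ds onv Vv pv′ onlyPeg′ lands jumps′ unique)
  where
  m v : Hole
  m = h ⊕ d
  v = m ⊕ d
  p′ : Position
  p′ = afterJump p h d
  v≢h : v ≢ h
  v≢h = landing-≢-origin h d
  v≢m : v ≢ m
  v≢m v≡m = ¬Vm (subst V v≡m Vv)
  pv : p v ≡ false
  pv = ¬-not (λ pv → v≢h (onlyPeg Vv pv))
  pv′ : p′ v ≡ true
  pv′ = afterJump-landing p h d v≢h v≢m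
  onlyPeg′ : ∀ {x} → V x → p′ x ≡ true → x ≡ v
  onlyPeg′ {x} Vx peg with afterJump-peg p h d x peg
  ... | inj₁ x≡v          = x≡v
  ... | inj₂ (x≢h , px)  = contradiction (onlyPeg Vx px) x≢h
  unchanged : ∀ {x} → ¬ V x → m ≢ x → p′ x ≡ p x
  unchanged ¬Vx m≢x = afterJump-frame p h d (λ x≡h → ¬Vx (subst V (sym x≡h) Vh)) (m≢x ∘ sym)
                                            (λ x≡v → ¬Vx (subst V (sym x≡v) Vv))
  jumps′ : All (λ x → OnBoard n x × ¬ V x × p′ x ≡ true) (jumpedOver v ds)
  jumps′ = All.zipWith (λ ((onx , ¬Vx , px) , m≢x) → onx , ¬Vx , trans (unchanged ¬Vx m≢x) px)
                       (jumps , m∉jumps)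

-- Routes in natural coordinates

Cell : Set
Cell = ℕ × ℕ

hole : Cell → Hole
hole (r , c) = (+ r , + c)

hole-injective : ∀ {x y} → hole x ≡ hole y → x ≡ y
hole-injective {r , c} {r′ , c′} eq =
  cong₂ _,_ (ℤ.+-injective (cong proj₁ eq)) (ℤ.+-injective (cong proj₂ eq))

shift : Dir → Cell → Cell
shift E  (r , c) = (r , suc c)
shift W  (r , c) = (r , pred c)
shift S  (r , c) = (suc r , c)
shift N  (r , c) = (pred r , c)
shift SE (r , c) = (suc r , suc c)
shift NW (r , c) = (pred r , pred c)

Positive : Pred Cell 0ℓ
Positive (r , c) = 1 ≤ r × 1 ≤ c

-- `shift` truncates at 0, so it follows `_⊕_` only away from the border.
hole-⊕ : ∀ d {x} → Positive x → hole x ⊕ d ≡ hole (shift d x)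
hole-⊕ E  {suc r , suc c} _ = cong₂ (λ a b → (+ a , + b)) (ℕ.+-identityʳ (suc r)) (ℕ.+-comm (suc c) 1)
hole-⊕ W  {suc r , suc c} _ = cong (λ a → (+ a , + c)) (ℕ.+-identityʳ (suc r))
hole-⊕ S  {suc r , suc c} _ = cong₂ (λ a b → (+ a , + b)) (ℕ.+-comm (suc r) 1) (ℕ.+-identityʳ (suc c))
hole-⊕ N  {suc r , suc c} _ = cong (λ b → (+ r , + b)) (ℕ.+-identityʳ (suc c))
hole-⊕ SE {suc r , suc c} _ = cong₂ (λ a b → (+ a , + b)) (ℕ.+-comm (suc r) 1) (ℕ.+-comm (suc c) 1)
hole-⊕ NW {suc r , suc c} _ = refl

jumpedCells : Cell → List Dir → List Cell
jumpedCells h []       = []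
jumpedCells h (d ∷ ds) = shift d h ∷ jumpedCells (shift d (shift d h)) ds

landedCells : Cell → List Dir → List Cell
landedCells h []       = []
landedCells h (d ∷ ds) = shift d (shift d h) ∷ landedCells (shift d (shift d h)) ds

lastCell : Cell → List Dir → Cell
lastCell h []       = h
lastCell h (d ∷ ds) = lastCell (shift d (shift d h)) ds

jumpedCells-++ : ∀ h ds es → jumpedCells h (ds ++ es) ≡ jumpedCells h ds ++ jumpedCells (lastCell h ds) es
jumpedCells-++ h []       es = refl
jumpedCells-++ h (d ∷ ds) es = cong (_ ∷_) (jumpedCells-++ _ ds es)

landedCells-++ : ∀ h ds es → landedCells h (ds ++ es) ≡ landedCells h ds ++ landedCells (lastCell h ds) es
landedCells-++ h []       es = refl
landedCells-++ h (d ∷ ds) es = cong (_ ∷_) (landedCells-++ _ ds es)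

lastCell-++ : ∀ h ds es → lastCell h (ds ++ es) ≡ lastCell (lastCell h ds) es
lastCell-++ h []       es = refl
lastCell-++ h (d ∷ ds) es = lastCell-++ _ ds es

route-hole : ∀ h ds → Positive h →
  All Positive (jumpedCells h ds) → All Positive (landedCells h ds) →
  jumpedOver (hole h) ds ≡ map hole (jumpedCells h ds) ×
  landedIn (hole h) ds ≡ map hole (landedCells h ds) ×
  endHole (hole h) ds ≡ hole (lastCell h ds)
route-hole h []       _    _               _               = refl , refl , refl
route-hole h (d ∷ ds) posh (posm ∷ jumps) (posv ∷ lands)
  with route-hole (shift d (shift d h)) ds posv jumps lands
... | jumped , landed , end =
  cong₂ _∷_ m≡ (trans (cong (λ x → jumpedOver x ds) v≡) jumped) ,
  cong₂ _∷_ v≡ (trans (cong (λ x → landedIn x ds) v≡) landed) ,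
  trans (cong (λ x → endHole x ds) v≡) end
  where
  m≡ : hole h ⊕ d ≡ hole (shift d h)
  m≡ = hole-⊕ d posh
  v≡ : (hole h ⊕ d) ⊕ d ≡ hole (shift d (shift d h))
  v≡ = trans (cong (_⊕ d) m≡) (hole-⊕ d posm)

-- Tours

Odd : Pred Hole 0ℓ
Odd (r , k) = isEven r ≡ false × isEven k ≡ false

OnTriangle : ℕ → Pred Cell 0ℓ
OnTriangle n (r , c) = 1 ≤ c × c ≤ r × r ≤ n

OnTriangle⇒Positive : ∀ {n x} → OnTriangle n x → Positive x
OnTriangle⇒Positive (1≤c , c≤r , _) = ℕ.≤-trans 1≤c c≤r , 1≤c

OnTriangle⇒OnBoard : ∀ {n x} → OnTriangle n x → OnBoard n (hole x)
OnTriangle⇒OnBoard (1≤c , c≤r , r≤n) = ℤ.+≤+ 1≤c , ℤ.+≤+ c≤r , ℤ.+≤+ r≤n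

OnBoard⇒OnTriangle : ∀ {n} x → OnBoard n x → ∃ λ c → x ≡ hole c × OnTriangle n c
OnBoard⇒OnTriangle (+ r , + c) (ℤ.+≤+ 1≤c , ℤ.+≤+ c≤r , ℤ.+≤+ r≤n) = (r , c) , refl , 1≤c , c≤r , r≤n

-- `Region` bounds the jumped cells (to keep jumps of concatenated tours
-- apart); `Covered` is a set of cells the tour is guaranteed to visit.
record Tour (n : ℕ) (h : Cell) (ds : List Dir) (h′ : Cell) (Region Covered : Pred Cell 0ℓ) : Set where
  field
    ends        : lastCell h ds ≡ h′
    jumpedValid : All (λ x → OnTriangle n x × ¬ Odd (hole x)) (jumpedCells h ds)
    landedValid : All (λ x → OnTriangle n x × Odd (hole x)) (landedCells h ds)
    jumpedIn    : All Region (jumpedCells h ds)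
    unique      : Unique (jumpedCells h ds)
    covers      : ∀ {x} → Covered x → x ∈ jumpedCells h ds ⊎ x ∈ landedCells h ds

open Tour

module _ {n : ℕ} where

  Tour-[] : ∀ {h R} → Tour n h [] h R ∅
  Tour-[] = record
    { ends = refl ; jumpedValid = [] ; landedValid = [] ; jumpedIn = [] ; unique = [] ; covers = λ () }

  Tour-jump : ∀ h d → let m = shift d h ; v = shift d m in
    OnTriangle n m → ¬ Odd (hole m) → OnTriangle n v → Odd (hole v) →
    Tour n h (d ∷ []) v ｛ m ｝ (｛ m ｝ ∪ ｛ v ｝)
  Tour-jump h d onm ¬oddm onv oddv = record
    { ends        = refl
    ; jumpedValid = (onm , ¬oddm) ∷ []
    ; landedValid = (onv , oddv) ∷ []
    ; jumpedIn    = refl ∷ []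
    ; unique      = [] ∷ []
    ; covers      = λ { (inj₁ refl) → inj₁ (here refl) ; (inj₂ refl) → inj₂ (here refl) }
    }

  Tour-weaken : ∀ {h ds h′ R R′ C C′} → R ⊆ R′ → C′ ⊆ C → Tour n h ds h′ R C → Tour n h ds h′ R′ C′
  Tour-weaken R⊆R′ C′⊆C t = record
    { ends = ends t ; jumpedValid = jumpedValid t ; landedValid = landedValid t
    ; jumpedIn = All.map R⊆R′ (jumpedIn t) ; unique = unique t ; covers = covers t ∘ C′⊆C }

  Tour-++ : ∀ {h ds h′ es h″ R R′ C C′} → Tour n h ds h′ R C → Tour n h′ es h″ R′ C′ → R ⊥ R′ →
    Tour n h (ds ++ es) h″ (R ∪ R′) (C ∪ C′)
  Tour-++ {h} {ds} {h′} {es} t t′ R⊥R′ with refl ← ends t = record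
    { ends        = trans (lastCell-++ h ds es) (ends t′)
    ; jumpedValid = subst (All _) J≡ (All.++⁺ (jumpedValid t) (jumpedValid t′))
    ; landedValid = subst (All _) L≡ (All.++⁺ (landedValid t) (landedValid t′))
    ; jumpedIn    = subst (All _) J≡ (All.++⁺ (All.map inj₁ (jumpedIn t)) (All.map inj₂ (jumpedIn t′)))
    ; unique      = subst Unique J≡ (Unique.++⁺ (unique t) (unique t′)
                      (λ (x∈ , x∈′) → R⊥R′ (All.lookup (jumpedIn t) x∈ , All.lookup (jumpedIn t′) x∈′)))
    ; covers      = Sum.map (subst (_ ∈_) J≡) (subst (_ ∈_) L≡) ∘
                      λ { (inj₁ c) → Sum.map ∈-++⁺ˡ ∈-++⁺ˡ (covers t c)
                        ; (inj₂ c) → Sum.map (∈-++⁺ʳ _) (∈-++⁺ʳ _) (covers t′ c) }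
    }
    where
    J≡ : jumpedCells h ds ++ jumpedCells (lastCell h ds) es ≡ jumpedCells h (ds ++ es)
    J≡ = sym (jumpedCells-++ h ds es)
    L≡ : landedCells h ds ++ landedCells (lastCell h ds) es ≡ landedCells h (ds ++ es)
    L≡ = sym (landedCells-++ h ds es)

-- The sweep route

double : ℕ → ℕ
double zero    = zero
double (suc n) = suc (suc (double n))

double-mono-≤ : ∀ {j k} → j ≤ k → double j ≤ double k
double-mono-≤ z≤n       = z≤n
double-mono-≤ (s≤s j≤k) = s≤s (s≤s (double-mono-≤ j≤k))

isEven-double : ∀ j → isEven (+ double j) ≡ true
isEven-double zero    = refl
isEven-double (suc j) = isEven-double j

isEven-suc-double : ∀ j → isEven (+ suc (double j)) ≡ false
isEven-suc-double zero    = refl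
isEven-suc-double (suc j) = isEven-suc-double j

Odd-odd : ∀ a b → Odd (hole (suc (double a) , suc (double b)))
Odd-odd a b = isEven-suc-double a , isEven-suc-double b

¬Odd-evenRow : ∀ j c → ¬ Odd (hole (double j , c))
¬Odd-evenRow j c (odd , _) with () ← trans (sym (isEven-double j)) odd

¬Odd-evenColumn : ∀ r j → ¬ Odd (hole (r , double j))
¬Odd-evenColumn r j (_ , odd) with () ← trans (sym (isEven-double j)) odd

≤-suc-suc-split : ∀ {x k} → x ≤ suc (suc k) → x ≤ k ⊎ x ≡ suc k ⊎ x ≡ suc (suc k)
≤-suc-suc-split x≤ with ℕ.m≤n⇒m<n∨m≡n x≤
... | inj₂ x≡ = inj₂ (inj₂ x≡)
... | inj₁ (s≤s x≤′) with ℕ.m≤n⇒m<n∨m≡n x≤′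
...   | inj₂ x≡        = inj₂ (inj₁ x≡)
...   | inj₁ (s≤s x≤″) = inj₁ x≤″

run : Dir → ℕ → List Dir
run d zero    = []
run d (suc t) = run d t ++ d ∷ []

LeftEdge : ℕ → Pred Cell 0ℓ
LeftEdge t (r , c) = c ≡ 1 × 2 ≤ r × r ≤ suc (double t)

descent-tour : ∀ {n} t → suc (double t) ≤ n →
  Tour n (1 , 1) (run S t) (suc (double t) , 1) (LeftEdge t) (LeftEdge t)
descent-tour zero _ = Tour-weaken {R = ∅} (λ ()) (λ (_ , 2≤r , r≤1) → ℕ.1+n≰n (ℕ.≤-trans 2≤r r≤1)) Tour-[]
descent-tour {n} (suc t) 2t+3≤n = Tour-weaken grow split
  (Tour-++ (descent-tour t (ℕ.≤-trans (ℕ.m≤n+m _ 2) 2t+3≤n))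
           (Tour-jump _ S (s≤s z≤n , s≤s z≤n , ℕ.≤-trans (ℕ.n≤1+n _) 2t+3≤n) (¬Odd-evenRow (suc t) 1)
                          (s≤s z≤n , s≤s z≤n , 2t+3≤n) (Odd-odd (suc t) 0))
           (λ { ((_ , _ , r≤) , refl) → ℕ.1+n≰n r≤ }))
  where
  grow : LeftEdge t ∪ ｛ (double (suc t) , 1) ｝ ⊆ LeftEdge (suc t)
  grow (inj₁ (c≡1 , 2≤r , r≤)) = c≡1 , 2≤r , ℕ.≤-trans r≤ (ℕ.m≤n+m _ 2)
  grow (inj₂ refl)             = refl , s≤s (s≤s z≤n) , ℕ.n≤1+n _
  split : LeftEdge (suc t) ⊆ LeftEdge t ∪ (｛ (double (suc t) , 1) ｝ ∪ ｛ (suc (double (suc t)) , 1) ｝)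
  split (refl , 2≤r , r≤) with ≤-suc-suc-split r≤
  ... | inj₁ r≤′        = inj₁ (refl , 2≤r , r≤′)
  ... | inj₂ (inj₁ refl) = inj₂ (inj₁ refl)
  ... | inj₂ (inj₂ refl) = inj₂ (inj₂ refl)

RowSpan : ℕ → ℕ → Pred Cell 0ℓ
RowSpan r t (r′ , c) = r′ ≡ r × 2 ≤ c × c ≤ suc (double t)

east-tour : ∀ {n} a t → suc (double a) ≤ n → t ≤ a →
  Tour n (suc (double a) , 1) (run E t) (suc (double a) , suc (double t))
    (RowSpan (suc (double a)) t) (RowSpan (suc (double a)) t)
east-tour a zero _ _ = Tour-weaken {R = ∅} (λ ()) (λ (_ , 2≤c , c≤1) → ℕ.1+n≰n (ℕ.≤-trans 2≤c c≤1)) Tour-[]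
east-tour {n} a (suc t) row≤n t<a = Tour-weaken grow split
  (Tour-++ (east-tour a t row≤n (ℕ.≤-trans (ℕ.n≤1+n t) t<a))
           (Tour-jump _ E (s≤s z≤n , ℕ.≤-trans (ℕ.n≤1+n _) 2t+3≤row , row≤n) (¬Odd-evenColumn (suc (double a)) (suc t))
                          (s≤s z≤n , 2t+3≤row , row≤n) (Odd-odd a (suc t)))
           (λ { ((_ , _ , c≤) , refl) → ℕ.1+n≰n c≤ }))
  where
  2t+3≤row : suc (double (suc t)) ≤ suc (double a)
  2t+3≤row = s≤s (double-mono-≤ t<a)
  grow : RowSpan _ t ∪ ｛ (suc (double a) , double (suc t)) ｝ ⊆ RowSpan _ (suc t)
  grow (inj₁ (r≡ , 2≤c , c≤)) = r≡ , 2≤c , ℕ.≤-trans c≤ (ℕ.m≤n+m _ 2)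
  grow (inj₂ refl)            = refl , s≤s (s≤s z≤n) , ℕ.n≤1+n _
  split : RowSpan _ (suc t) ⊆
    RowSpan _ t ∪ (｛ (suc (double a) , double (suc t)) ｝ ∪ ｛ (suc (double a) , suc (double (suc t))) ｝)
  split (refl , 2≤c , c≤) with ≤-suc-suc-split c≤
  ... | inj₁ c≤′         = inj₁ (refl , 2≤c , c≤′)
  ... | inj₂ (inj₁ refl) = inj₂ (inj₁ refl)
  ... | inj₂ (inj₂ refl) = inj₂ (inj₂ refl)

zigzag : ℕ → List Dir
zigzag zero    = NW ∷ []
zigzag (suc j) = NW ∷ S ∷ zigzag j

ZigzagSpan : ℕ → ℕ → Pred Cell 0ℓ
ZigzagSpan i j (r , c) = r ≡ double (suc i) × 2 ≤ c × c ≤ double (suc j)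

zigzag-tour : ∀ {n} i j → j ≤ i → suc (double (suc i)) ≤ n →
  Tour n (suc (double (suc i)) , suc (double (suc j))) (zigzag j) (suc (double i) , 1)
    (ZigzagSpan i j) (ZigzagSpan i j ∪ ｛ (suc (double i) , 1) ｝)
zigzag-tour {n} i zero _ 2i+3≤n = Tour-weaken grow split
  (Tour-jump _ NW (s≤s z≤n , s≤s (s≤s z≤n) , 2i+2≤n) (¬Odd-evenRow (suc i) 2)
                  (s≤s z≤n , s≤s z≤n , ℕ.≤-trans (ℕ.m≤n+m _ 2) 2i+3≤n) (Odd-odd i 0))
  where
  2i+2≤n : double (suc i) ≤ n
  2i+2≤n = ℕ.≤-trans (ℕ.n≤1+n _) 2i+3≤n
  grow : ｛ (double (suc i) , 2) ｝ ⊆ ZigzagSpan i 0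
  grow refl = refl , ℕ.≤-refl , ℕ.≤-refl
  split : ZigzagSpan i 0 ∪ ｛ (suc (double i) , 1) ｝ ⊆ ｛ (double (suc i) , 2) ｝ ∪ ｛ (suc (double i) , 1) ｝
  split (inj₁ (refl , 2≤c , c≤2)) = inj₁ (cong (_ ,_) (ℕ.≤-antisym 2≤c c≤2))
  split (inj₂ x≡)                 = inj₂ x≡
zigzag-tour {n} i (suc j) j<i 2i+3≤n =
  Tour-weaken grow split (Tour-++ northwest (Tour-++ south rest south⊥rest) northwest⊥rest)
  where
  m₁ v₁ m₂ v₂ end : Cell
  m₁  = (double (suc i) , double (suc (suc j)))
  v₁  = (suc (double i) , suc (double (suc j)))
  m₂  = (double (suc i) , suc (double (suc j)))
  v₂  = (suc (double (suc i)) , suc (double (suc j)))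
  end = (suc (double i) , 1)
  2i+2≤n : double (suc i) ≤ n
  2i+2≤n = ℕ.≤-trans (ℕ.n≤1+n _) 2i+3≤n
  2j+3≤2i+1 : suc (double (suc j)) ≤ suc (double i)
  2j+3≤2i+1 = s≤s (double-mono-≤ j<i)
  northwest : Tour n (suc (double (suc i)) , suc (double (suc (suc j)))) (NW ∷ []) v₁
                ｛ m₁ ｝ (｛ m₁ ｝ ∪ ｛ v₁ ｝)
  northwest = Tour-jump _ NW (s≤s z≤n , double-mono-≤ (s≤s j<i) , 2i+2≤n) (¬Odd-evenRow (suc i) (proj₂ m₁))
                             (s≤s z≤n , 2j+3≤2i+1 , ℕ.≤-trans (ℕ.m≤n+m _ 2) 2i+3≤n) (Odd-odd i (suc j))
  south : Tour n v₁ (S ∷ []) v₂ ｛ m₂ ｝ (｛ m₂ ｝ ∪ ｛ v₂ ｝)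
  south = Tour-jump _ S (s≤s z≤n , ℕ.≤-trans 2j+3≤2i+1 (ℕ.n≤1+n _) , 2i+2≤n) (¬Odd-evenRow (suc i) (proj₂ m₂))
                        (s≤s z≤n , ℕ.≤-trans 2j+3≤2i+1 (ℕ.m≤n+m _ 2) , 2i+3≤n) (Odd-odd (suc i) (suc j))
  rest : Tour n v₂ (zigzag j) end (ZigzagSpan i j) (ZigzagSpan i j ∪ ｛ end ｝)
  rest = zigzag-tour i j (ℕ.≤-trans (ℕ.n≤1+n j) j<i) 2i+3≤n
  south⊥rest : ｛ m₂ ｝ ⊥ ZigzagSpan i j
  south⊥rest (refl , (_ , _ , c≤)) = ℕ.1+n≰n c≤
  northwest⊥rest : ｛ m₁ ｝ ⊥ (｛ m₂ ｝ ∪ ZigzagSpan i j)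
  northwest⊥rest (refl , inj₁ m₂≡m₁)         = ℕ.1+n≢n (cong proj₂ (sym m₂≡m₁))
  northwest⊥rest (refl , inj₂ (_ , _ , c≤)) = ℕ.1+n≰n (ℕ.≤-trans (ℕ.n≤1+n _) c≤)
  grow : ｛ m₁ ｝ ∪ (｛ m₂ ｝ ∪ ZigzagSpan i j) ⊆ ZigzagSpan i (suc j)
  grow (inj₁ refl)                     = refl , s≤s (s≤s z≤n) , ℕ.≤-refl
  grow (inj₂ (inj₁ refl))              = refl , s≤s (s≤s z≤n) , ℕ.n≤1+n _
  grow (inj₂ (inj₂ (r≡ , 2≤c , c≤))) = r≡ , 2≤c , ℕ.≤-trans c≤ (ℕ.m≤n+m _ 2)
  split : ZigzagSpan i (suc j) ∪ ｛ end ｝ ⊆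
    (｛ m₁ ｝ ∪ ｛ v₁ ｝) ∪ ((｛ m₂ ｝ ∪ ｛ v₂ ｝) ∪ (ZigzagSpan i j ∪ ｛ end ｝))
  split (inj₂ end≡) = inj₂ (inj₂ (inj₂ end≡))
  split (inj₁ (refl , 2≤c , c≤)) with ≤-suc-suc-split c≤
  ... | inj₁ c≤′         = inj₂ (inj₂ (inj₁ (refl , 2≤c , c≤′)))
  ... | inj₂ (inj₁ refl) = inj₂ (inj₁ (inj₁ refl))
  ... | inj₂ (inj₂ refl) = inj₁ (inj₁ refl)

loop : ℕ → List Dir
loop i = run E (suc i) ++ zigzag i

loop-tour : ∀ {n} i → suc (double (suc i)) ≤ n →
  Tour n (suc (double (suc i)) , 1) (loop i) (suc (double i) , 1)
    (RowSpan (suc (double (suc i))) (suc i) ∪ ZigzagSpan i i)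
    (RowSpan (suc (double (suc i))) (suc i) ∪ (ZigzagSpan i i ∪ ｛ (suc (double i) , 1) ｝))
loop-tour i 2i+3≤n = Tour-++ (east-tour (suc i) (suc i) 2i+3≤n ℕ.≤-refl) (zigzag-tour i i ℕ.≤-refl 2i+3≤n)
  (λ { ((refl , _) , (r≡ , _)) → ℕ.1+n≢n r≡ })

loops : ℕ → List Dir
loops zero    = []
loops (suc i) = loop i ++ loops i

Above : ℕ → Pred Cell 0ℓ
Above i (r , c) = 2 ≤ c × r ≤ suc (double i)

UpperTriangle : ℕ → Pred Cell 0ℓ
UpperTriangle i (r , c) = 2 ≤ c × c ≤ r × r ≤ suc (double i)

-- Loop j ends on the left edge in row 2j+1; for j = 0 this is the apex a1, which
-- no jump passes over.
LoopsCovered : ℕ → Pred Cell 0ℓ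
LoopsCovered i = UpperTriangle i ∪ (λ x → ∃ λ j → j ℕ.< i × (suc (double j) , 1) ≡ x)

loops-tour : ∀ {n} i → suc (double i) ≤ n →
  Tour n (suc (double i) , 1) (loops i) (1 , 1) (Above i) (LoopsCovered i)
loops-tour zero _ = Tour-weaken {R = ∅} (λ ()) empty Tour-[]
  where
  empty : LoopsCovered 0 ⊆ ∅
  empty (inj₁ (2≤c , c≤r , r≤1)) = ℕ.1+n≰n (ℕ.≤-trans 2≤c (ℕ.≤-trans c≤r r≤1))
  empty (inj₂ (_ , () , _))
loops-tour {n} (suc i) 2i+3≤n = Tour-weaken grow split
  (Tour-++ (loop-tour i 2i+3≤n) (loops-tour i (ℕ.≤-trans (ℕ.m≤n+m _ 2) 2i+3≤n))
    (λ { (inj₁ (refl , _) , (_ , r≤)) → ℕ.1+n≰n (ℕ.≤-trans (ℕ.n≤1+n _) r≤)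
       ; (inj₂ (refl , _) , (_ , r≤)) → ℕ.1+n≰n r≤ }))
  where
  grow : (RowSpan (suc (double (suc i))) (suc i) ∪ ZigzagSpan i i) ∪ Above i ⊆ Above (suc i)
  grow (inj₁ (inj₁ (refl , 2≤c , _))) = 2≤c , ℕ.≤-refl
  grow (inj₁ (inj₂ (refl , 2≤c , _))) = 2≤c , ℕ.n≤1+n _
  grow (inj₂ (2≤c , r≤))              = 2≤c , ℕ.≤-trans r≤ (ℕ.m≤n+m _ 2)
  split : LoopsCovered (suc i) ⊆
    (RowSpan (suc (double (suc i))) (suc i) ∪ (ZigzagSpan i i ∪ ｛ (suc (double i) , 1) ｝)) ∪ LoopsCovered i
  split (inj₁ (2≤c , c≤r , r≤)) with ≤-suc-suc-split r≤
  ... | inj₁ r≤′         = inj₂ (inj₁ (2≤c , c≤r , r≤′))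
  ... | inj₂ (inj₁ refl) = inj₁ (inj₂ (inj₁ (refl , 2≤c , c≤r)))
  ... | inj₂ (inj₂ refl) = inj₁ (inj₁ (refl , 2≤c , c≤r))
  split (inj₂ (j , j<1+i , refl)) with ℕ.m≤n⇒m<n∨m≡n (ℕ.≤-pred j<1+i)
  ... | inj₁ j<i  = inj₂ (inj₂ (j , j<i , refl))
  ... | inj₂ refl = inj₁ (inj₂ (inj₂ refl))

sweepRoute : ℕ → List Dir
sweepRoute m = run S m ++ loops m

sweepRoute-tour : ∀ m → Tour (suc (double m)) (1 , 1) (sweepRoute m) (1 , 1)
  (LeftEdge m ∪ Above m) (LeftEdge m ∪ LoopsCovered m)
sweepRoute-tour m = Tour-++ (descent-tour m ℕ.≤-refl) (loops-tour m ℕ.≤-refl)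
  (λ { ((refl , _) , (s≤s () , _)) })

OnTriangle-covered : ∀ m → 1 ≤ m → OnTriangle (suc (double m)) ⊆ LeftEdge m ∪ LoopsCovered m
OnTriangle-covered m 1≤m {r , suc (suc c)} (_ , c≤r , r≤n) = inj₂ (inj₁ (s≤s (s≤s z≤n) , c≤r , r≤n))
OnTriangle-covered m 1≤m {suc zero , suc zero} _ = inj₂ (inj₂ (0 , 1≤m , refl))
OnTriangle-covered m 1≤m {suc (suc r) , suc zero} (_ , _ , r≤n) = inj₁ (refl , s≤s (s≤s z≤n) , r≤n)

double≡2* : ∀ n → double n ≡ 2 * n
double≡2* zero    = refl
double≡2* (suc n) = trans (cong (suc ∘ suc) (double≡2* n)) (sym (ℕ.*-distribˡ-+ 2 1 n))

odd⇒suc-double : ∀ n → n % 2 ≡ 1 → n ≡ suc (double (n / 2))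
odd⇒suc-double n odd = begin
  n                  ≡⟨ m≡m%n+[m/n]*n n 2 ⟩
  n % 2 + n / 2 * 2  ≡⟨ cong₂ _+_ odd (trans (ℕ.*-comm (n / 2) 2) (sym (double≡2* (n / 2)))) ⟩
  suc (double (n / 2)) ∎
  where open ≡-Reasoning

length-run : ∀ d t → length (run d t) ≡ t
length-run d zero    = refl
length-run d (suc t) = trans (length-++ (run d t)) (trans (cong (_+ 1) (length-run d t)) (ℕ.+-comm t 1))

length-zigzag : ∀ j → length (zigzag j) ≡ suc (double j)
length-zigzag zero    = refl
length-zigzag (suc j) = cong (suc ∘ suc) (length-zigzag j)

length-loop : ∀ i → length (loop i) ≡ 3 * i + 2
length-loop i = begin
  length (run E (suc i) ++ zigzag i)           ≡⟨ length-++ (run E (suc i)) ⟩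
  length (run E (suc i)) + length (zigzag i)   ≡⟨ cong₂ _+_ (length-run E (suc i)) (length-zigzag i) ⟩
  suc i + suc (double i)                       ≡⟨ cong (λ k → suc i + suc k) (double≡2* i) ⟩
  suc i + suc (2 * i)                          ≡⟨ arith i ⟩
  3 * i + 2                                     ∎
  where
  open ≡-Reasoning
  arith : ∀ i → suc i + suc (2 * i) ≡ 3 * i + 2
  arith = solve-∀

length-loops : ∀ i → 2 * length (loops i) ≡ i * (3 * i + 1)
length-loops zero    = refl
length-loops (suc i) = begin
  2 * length (loop i ++ loops i)              ≡⟨ cong (2 *_) (length-++ (loop i)) ⟩
  2 * (length (loop i) + length (loops i))    ≡⟨ ℕ.*-distribˡ-+ 2 (length (loop i)) _ ⟩
  2 * length (loop i) + 2 * length (loops i)  ≡⟨ cong₂ _+_ (cong (2 *_) (length-loop i)) (length-loops i) ⟩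
  2 * (3 * i + 2) + i * (3 * i + 1)           ≡⟨ arith i ⟩
  suc i * (3 * suc i + 1)                     ∎
  where
  open ≡-Reasoning
  arith : ∀ i → 2 * (3 * i + 2) + i * (3 * i + 1) ≡ suc i * (3 * suc i + 1)
  arith = solve-∀

length-sweepRoute : ∀ m → 8 * length (sweepRoute m) ≡ 3 * (suc (double m) * suc (double m) ∸ 1)
length-sweepRoute m = begin
  8 * length (run S m ++ loops m)            ≡⟨ cong (8 *_) (length-++ (run S m)) ⟩
  8 * (length (run S m) + length (loops m))  ≡⟨ cong (λ k → 8 * (k + length (loops m))) (length-run S m) ⟩
  8 * (m + length (loops m))                 ≡⟨ regroup m (length (loops m)) ⟩
  8 * m + 4 * (2 * length (loops m))         ≡⟨ cong (λ k → 8 * m + 4 * k) (length-loops m) ⟩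
  8 * m + 4 * (m * (3 * m + 1))              ≡⟨ arith m ⟩
  3 * (2 * m + 2 * m * suc (2 * m))          ≡⟨ cong (λ k → 3 * (k + k * suc k)) (double≡2* m) ⟨
  3 * (suc (double m) * suc (double m) ∸ 1)  ∎
  where
  open ≡-Reasoning
  regroup : ∀ m l → 8 * (m + l) ≡ 8 * m + 4 * (2 * l)
  regroup = solve-∀
  arith : ∀ m → 8 * m + 4 * (m * (3 * m + 1)) ≡ 3 * (2 * m + 2 * m * suc (2 * m))
  arith = solve-∀

initialPosition-Odd : ∀ {x} → Odd x → initialPosition x ≡ true → x ≡ a1
initialPosition-Odd {x@(r , k)} (r-odd , k-odd) peg
  rewrite r-odd | k-odd | ∨-identityʳ (x == a1) = ==⇒≡ peg

initialPosition-¬Odd : ∀ {x} → ¬ Odd x → initialPosition x ≡ true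
initialPosition-¬Odd {x@(r , k)} ¬odd with isEven r | isEven k
... | true  | _     = ∨-zeroʳ (x == a1)
... | false | true  = ∨-zeroʳ (x == a1)
... | false | false = contradiction (refl , refl) ¬odd

closedTour⇒sweep : ∀ {n ds R C} → 1 ≤ n → Tour n (1 , 1) ds (1 , 1) R C →
  ∃ λ p′ → Sweep n initialPosition a1 ds p′ a1 ×
           (∀ {x} → C x → hole x ∈ jumpedOver a1 ds ⊎ hole x ∈ landedIn a1 ds)
closedTour⇒sweep {n} {ds} {C = C} 1≤n t
  with route-hole (1 , 1) ds (s≤s z≤n , s≤s z≤n)
         (All.map (OnTriangle⇒Positive ∘ proj₁) (jumpedValid t))
         (All.map (OnTriangle⇒Positive ∘ proj₁) (landedValid t))
... | jumped≡ , landed≡ , end≡ =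
  map₂ (λ sweep → subst (Sweep n initialPosition a1 ds _) (trans end≡ (cong hole (ends t))) sweep , covered)
       (sweep-of-route Odd ds (ℤ.+≤+ ℕ.≤-refl , ℤ.+≤+ ℕ.≤-refl , ℤ.+≤+ 1≤n) (refl , refl) refl
          initialPosition-Odd lands jumps uniq)
  where
  lands : All (λ x → OnBoard n x × Odd x) (landedIn a1 ds)
  lands = subst (All _) (sym landed≡)
            (All.map⁺ (All.map (λ (on , odd) → OnTriangle⇒OnBoard on , odd) (landedValid t)))
  jumps : All (λ x → OnBoard n x × ¬ Odd x × initialPosition x ≡ true) (jumpedOver a1 ds)
  jumps = subst (All _) (sym jumped≡)
            (All.map⁺ (All.map (λ {x} (on , ¬odd) → OnTriangle⇒OnBoard on , ¬odd , initialPosition-¬Odd {hole x} ¬odd)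
                               (jumpedValid t)))
  uniq : Unique (jumpedOver a1 ds)
  uniq = subst Unique (sym jumped≡) (Unique.map⁺ hole-injective (unique t))
  covered : ∀ {x} → C x → hole x ∈ jumpedOver a1 ds ⊎ hole x ∈ landedIn a1 ds
  covered c = Sum.map (subst (_ ∈_) (sym jumped≡) ∘ ∈-map⁺ hole)
                      (subst (_ ∈_) (sym landed≡) ∘ ∈-map⁺ hole) (covers t c)

mainTheorem2 : (n : ℕ) → 3 ≤ n → n % 2 ≡ 1 →
    Σ (List Dir) λ ds → ∃ λ p' →
      Sweep n initialPosition a1 ds p' a1 ×
      (8 * length ds ≡ 3 * (n * n ∸ 1)) ×
      ((x : Hole) → OnBoard n x → x ∈ jumpedOver a1 ds ⊎ x ∈ landedIn a1 ds)
mainTheorem2 n 3≤n odd with n / 2 | odd⇒suc-double n odd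
... | zero  | refl = contradiction 3≤n λ { (s≤s ()) }
... | suc k | refl with closedTour⇒sweep (s≤s z≤n) (sweepRoute-tour (suc k))
...   | p′ , sweep , covered = sweepRoute (suc k) , p′ , sweep , length-sweepRoute (suc k) , onBoard-covered
  where
  onBoard-covered : (x : Hole) → OnBoard (suc (double (suc k))) x →
    x ∈ jumpedOver a1 (sweepRoute (suc k)) ⊎ x ∈ landedIn a1 (sweepRoute (suc k))
  onBoard-covered x onx with OnBoard⇒OnTriangle x onx
  ... | c , refl , onc = covered (OnTriangle-covered (suc k) (s≤s z≤n) onc)
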